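{- Let $t$ be an introduce node with child $t'$ and $X_t\setminus X_{t'}=\{w\}$. Let $\mathcal{S}=(S_1,\ldots,S_k)$ be a $k$-tuple of subsets of $X_t$, let $\hat{\mathcal{S}}=(\hat S_1,\ldots,\hat S_k)$ be a $k$-tuple of subsets of $V_t$ with $\hat S_i\cap X_t=S_i$ for all $i$, and let $\hat{\mathcal{S}}'=(\hat S_1\setminus\{w\},\ldots,\hat S_k\setminus\{w\})$. Let $\hat D=D[V_t]\oplus\hat{\mathcal{S}}$ and $\hat D'=D[V_{t'}]\oplus\hat{\mathcal{S}}'$, and let $P'\subseteq P_{t'}$ be the set of pairs $(a,b)$ such that $\hat D'$ contains a directed path from $a$ to $b$. Then for every pair $(u,v)\in P_t$, $\hat D$ contains a directed path from $u$ to $v$ if and only if $A_{t,P',\mathcal{S}}$ contains a directed path from $u$ to $v$.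
   Context: Inversion: for an oriented graph $D$ and a tuple $(Y_1,\ldots,Y_k)$ of vertex subsets, $D\oplus(Y_1,\ldots,Y_k)$ is obtained by successively reversing every arc with both endpoints in $Y_1$, then $Y_2$, etc. (equivalently, $(u,v)$ is an arc of the result iff either $(u,v)\in E(D)$ and $\{u,v\}$ lies in an even number of the $Y_j$, or $(v,u)\in E(D)$ and $\{u,v\}$ lies in an odd number of the $Y_j$); sets may contain vertices outside the digraph, which cause no changes. Setting: $D$ is an oriented graph and $(T,\{X_t\})$ is a nice tree decomposition of its underlying undirected graph; for a node $t$, $V_t$ is the union of the bags of the subtree rooted at $t$, and $P_t$ is the set of ordered pairs of distinct vertices of $X_t$. An introduce node $t$ has a single child $t'$ with $X_t=X_{t'}\cup\{w\}$, $w\notin X_{t'}$. For $P'\subseteq P_{t'}$ and a $k$-tuple $\mathcal{S}$ of subsets of $X_t$, the auxiliary digraph $A_{t,P',\mathcal{S}}$ has vertex set $X_t$ and arc set consisting of $P'$ together with: all $(w,v)$ with $v\in X_{t'}$ such that either $(w,v)\in E(D[X_t])$ and $\{w,v\}$ lies in an even number of sets of $\mathcal{S}$, or $(v,w)\in E(D[X_t])$ and $\{w,v\}$ lies in an odd number of sets of $\mathcal{S}$; and all $(u,w)$ with $u\in X_{t'}$ such that either $(u,w)\in E(D[X_t])$ and $\{u,w\}$ lies in an even number of sets of $\mathcal{S}$, or $(w,u)\in E(D[X_t])$ and $\{u,w\}$ lies in an odd number of sets of $\mathcal{S}$. -}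

module Defs where

open import Data.Nat using (ℕ; zero; suc; _+_)
open import Data.Bool using (Bool; true; false; not; _∧_; if_then_else_; T)
open import Data.Fin using (Fin)
open import Data.Fin.Subset using (Subset; _∈_; _∉_; _∪_; _-_; ⁅_⁆) renaming (⊥ to ∅)
open import Data.Vec using (Vec; []; _∷_)
import Data.Vec as Vec
open import Data.List using (List; []; _∷_; length)
import Data.List as List
open import Data.List.Relation.Unary.Unique.Propositional using (Unique)
open import Data.Product using (Σ; ∃; ∃-syntax; _×_; _,_)
open import Data.Sum using (_⊎_)
open import Relation.Nullary using (¬_)
open import Relation.Binary.PropositionalEquality using (_≡_)

private variable n k : ℕ

Rel : ℕ → Set₁
Rel n = Fin n → Fin n → Set

record OrientedGraph (n : ℕ) : Set₁ where
  field
    arc      : Rel n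
    irrefl   : ∀ x → ¬ arc x x
    asym     : ∀ x y → arc x y → ¬ arc y x

-- Induced subdigraph D[S] (arcs with both endpoints in S; vertices
-- outside S carry no arcs).
induced : Subset n → Rel n → Rel n
induced S E u v = u ∈ S × v ∈ S × E u v

even : ℕ → Bool
even zero          = true
even (suc zero)    = false
even (suc (suc m)) = even m

Even Odd : ℕ → Set
Even m = T (even m)
Odd  m = T (not (even m))

count : Vec (Subset n) k → Fin n → Fin n → ℕ
count []       u v = 0
count (Y ∷ Ys) u v =
  (if Vec.lookup Y u ∧ Vec.lookup Y v then 1 else 0) + count Ys u v

invert : Rel n → Vec (Subset n) k → Rel n
invert E Ys u v =
  (E u v × Even (count Ys u v)) ⊎ (E v u × Odd (count Ys u v))

data Walk (R : Rel n) : Fin n → Fin n → Set where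
  []  : ∀ {x} → Walk R x x
  _∷_ : ∀ {x y z} → R x y → Walk R y z → Walk R x z

vertices : ∀ {R : Rel n} {x y} → Walk R x y → List (Fin n)
vertices {x = x} []      = x ∷ []
vertices {x = x} (_ ∷ p) = x ∷ vertices p

DirPath : Rel n → Fin n → Fin n → Set
DirPath R x y = Σ (Walk R x y) (λ p → Unique (vertices p))

-- Rooted trees with bags; nodes are positions in the tree.

data Tree (n : ℕ) : Set where
  node : Subset n → List (Tree n) → Tree n

rootBag : Tree n → Subset n
rootBag (node X _) = X

children : Tree n → List (Tree n)
children (node _ cs) = cs

mutual
  V : Tree n → Subset n
  V (node X cs) = X ∪ Vs cs

  Vs : List (Tree n) → Subset n
  Vs []       = ∅
  Vs (c ∷ cs) = V c ∪ Vs cs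

data Pos {n} : Tree n → Set where
  here  : ∀ {X cs} → Pos (node X cs)
  there : ∀ {X cs} (i : Fin (length cs)) → Pos (List.lookup cs i) → Pos (node X cs)

subtreeAt : ∀ {T : Tree n} → Pos T → Tree n
subtreeAt {T = T} here = T
subtreeAt (there i p)  = subtreeAt p

bag : ∀ {T : Tree n} → Pos T → Subset n
bag p = rootBag (subtreeAt p)

data _≼_ {n} : {T : Tree n} → Pos T → Pos T → Set where
  here≼  : ∀ {X cs} {q : Pos (node X cs)} → here ≼ q
  there≼ : ∀ {X cs} {i : Fin (length cs)} {p q : Pos (List.lookup cs i)} →
           p ≼ q → there {X = X} {cs = cs} i p ≼ there i q

-- s lies on the (unique) path of the tree between p and q
OnPath : ∀ {T : Tree n} → Pos T → Pos T → Pos T → Set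
OnPath s p q = (s ≼ p ⊎ s ≼ q) × (∀ a → a ≼ p → a ≼ q → a ≼ s)

record IsTreeDecomposition (D : OrientedGraph n) (T : Tree n) : Set where
  open OrientedGraph D
  field
    vertexCover : ∀ v → ∃[ p ] (v ∈ bag {T = T} p)
    edgeCover   : ∀ u v → (arc u v ⊎ arc v u) → ∃[ p ] (u ∈ bag {T = T} p × v ∈ bag p)
    coherence   : ∀ (p q s : Pos T) → OnPath s p q →
                  ∀ v → v ∈ bag p → v ∈ bag q → v ∈ bag s

NiceNode : Tree n → Set
NiceNode (node X cs) =
    (cs ≡ [] × X ≡ ∅)
  ⊎ (∃[ c ] ∃[ w ] (cs ≡ c ∷ [] × w ∉ rootBag c × X ≡ rootBag c ∪ ⁅ w ⁆))
  ⊎ (∃[ c ] ∃[ w ] (cs ≡ c ∷ [] × w ∈ rootBag c × X ≡ rootBag c - w))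
  ⊎ (∃[ c₁ ] ∃[ c₂ ] (cs ≡ c₁ ∷ c₂ ∷ [] × rootBag c₁ ≡ X × rootBag c₂ ≡ X))

record IsNiceTreeDecomposition (D : OrientedGraph n) (T : Tree n) : Set where
  field
    isTreeDecomposition : IsTreeDecomposition D T
    rootEmpty           : rootBag T ≡ ∅
    niceNodes           : ∀ (p : Pos T) → NiceNode (subtreeAt p)

auxDigraph : (E : Rel n) (Xt Xt' : Subset n) (w : Fin n) (P' : Rel n)
             (S : Vec (Subset n) k) → Rel n
auxDigraph E Xt Xt' w P' S x y =
    P' x y
  ⊎ (x ≡ w × y ∈ Xt' × invert (induced Xt E) S w y)
  ⊎ (y ≡ w × x ∈ Xt' × invert (induced Xt E) S x w)

{-# OPTIONS --safe #-}
module Submission where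

-- An introduce node separates w from everything strictly below it: w occurs in no bag of
-- the subtree of t', so every neighbour of w in V_t already lies in X_t'. Moreover Ŝ agrees
-- with Ŝ' on V_t' and with S on X_t, so D̂ coincides with D̂' away from w and with
-- D[X_t] ⊕ S on X_t. A path of D̂ between vertices of X_t is therefore cut, at its visits
-- to w, into segments running inside V_t' between vertices of X_t' (arcs of P') and steps
-- through w (arcs of A incident to w). Conversely every arc of A unfolds to a walk of D̂.
-- In both directions loop erasure turns the resulting walk into a path.

open import Defs
open import Data.Nat using (ℕ; _+_)
open import Data.Bool using (_∧_; if_then_else_)
open import Data.Bool.Properties using (⇔→≡)
open import Data.Fin using (Fin; zero; suc; _≟_)
open import Data.Fin.Subset using (Subset; _∈_; _∉_; _⊆_; _∩_; _∪_; _-_; ⁅_⁆)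
open import Data.Fin.Subset.Properties
  using (x∈p∩q⁺; p∩q⊆p; x∈p∪q⁻; x∈p∪q⁺; p⊆p∪q; q⊆p∪q; ∪-identityʳ; x∈p∧x≢y⇒x∈p-y; p─q⊆p; x∈⁅x⁆; x∈⁅y⁆⇒x≡y; ∉⊥)
open import Data.Vec using (Vec; lookup; map; []; _∷_)
open import Data.Vec.Properties using ([]=⇒lookup; lookup⇒[]=; lookup-map)
open import Data.List using (List; length; []; _∷_)
import Data.List as List
open import Data.List.Membership.Propositional using () renaming (_∈_ to _∈ˡ_)
open import Data.List.Relation.Unary.Any using (here; there; any?)
open import Data.List.Relation.Unary.All using (All)
open import Data.List.Relation.Unary.All.Properties using (¬Any⇒All¬)
open import Data.List.Relation.Unary.AllPairs using (AllPairs)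
open import Data.List.Relation.Unary.Unique.Propositional using (Unique)
open import Data.Product using (Σ-syntax; ∃-syntax; _×_; _,_; proj₁; proj₂)
import Data.Product as Product
open import Data.Sum using (_⊎_; inj₁; inj₂; [_,_]′)
import Data.Sum as Sum
open import Data.Empty using (⊥-elim)
open import Relation.Nullary using (¬_; yes; no)
open import Relation.Binary.PropositionalEquality using (_≡_; _≢_; refl; sym; trans; cong; cong₂; subst)
open import Function using (_∘_; id)
open import Function.Bundles using (_⇔_; mk⇔; Equivalence)

open Equivalence using (to; from)

module _ {n : ℕ} {R : Rel n} where

  infixr 5 _++ʷ_

  _++ʷ_ : ∀ {x y z} → Walk R x y → Walk R y z → Walk R x z
  []      ++ʷ q = q
  (e ∷ p) ++ʷ q = e ∷ (p ++ʷ q)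

  _∷ʳ_ : ∀ {x y z} → Walk R x y → R y z → Walk R x z
  p ∷ʳ e = p ++ʷ (e ∷ [])

  suffixFrom : ∀ {x y z} (p : Walk R x z) → y ∈ˡ vertices p →
               Σ[ q ∈ Walk R y z ] (Unique (vertices p) → Unique (vertices q))
  suffixFrom []      (here refl) = [] , λ p! → p!
  suffixFrom (e ∷ p) (here refl) = e ∷ p , λ p! → p!
  suffixFrom (e ∷ p) (there y∈p) =
    let q , q! = suffixFrom p y∈p in q , λ { (_ AllPairs.∷ p!) → q! p! }

  toDirPath : ∀ {x y} → Walk R x y → DirPath R x y
  toDirPath [] = [] , (All.[] AllPairs.∷ AllPairs.[])
  toDirPath {x} (e ∷ p) with toDirPath p
  ... | q , q! with any? (x ≟_) (vertices q)
  ...   | yes x∈q = let q' , q'! = suffixFrom q x∈q in q' , q'! q!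
  ...   | no  x∉q = e ∷ q , (¬Any⇒All¬ _ x∉q AllPairs.∷ q!)

bindʷ : ∀ {n} {R R' : Rel n} → (∀ {a b} → R a b → Walk R' a b) → ∀ {x y} → Walk R x y → Walk R' x y
bindʷ f []      = []
bindʷ f (e ∷ p) = f e ++ʷ bindʷ f p

module _ {n : ℕ} where

  ≼-trans : {T : Tree n} {a b c : Pos T} → a ≼ b → b ≼ c → a ≼ c
  ≼-trans here≼         _             = here≼
  ≼-trans (there≼ a≼b) (there≼ b≼c) = there≼ (≼-trans a≼b b≼c)

  ≼-comparable : {T : Tree n} {a b c : Pos T} → a ≼ c → b ≼ c → a ≼ b ⊎ b ≼ a
  ≼-comparable here≼        _             = inj₁ here≼
  ≼-comparable (there≼ _)   here≼         = inj₂ here≼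
  ≼-comparable (there≼ a≼c) (there≼ b≼c) = Sum.map there≼ there≼ (≼-comparable a≼c b≼c)

  between⇒onPath : {T : Tree n} {s p q : Pos T} → p ≼ s → s ≼ q → OnPath s p q
  between⇒onPath p≼s s≼q = inj₂ s≼q , λ a a≼p _ → ≼-trans a≼p p≼s

  subtreeRoot-onPath : {T : Tree n} {s p q : Pos T} → s ≼ q → ¬ s ≼ p → OnPath s p q
  subtreeRoot-onPath s≼q s⋠p = inj₂ s≼q , λ a a≼p a≼q →
    [ id , (λ s≼a → ⊥-elim (s⋠p (≼-trans s≼a a≼p))) ]′ (≼-comparable a≼q s≼q)

module _ {n : ℕ} where

  root : (T : Tree n) → Pos T
  root (node _ _) = here

  subtreeAt-root : (T : Tree n) → subtreeAt (root T) ≡ T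
  subtreeAt-root (node _ _) = refl

  rootBag⊆V : (T : Tree n) → rootBag T ⊆ V T
  rootBag⊆V (node _ cs) = p⊆p∪q (Vs cs)

  mutual
    ∈V⇒∈bag : (T : Tree n) {x : Fin n} → x ∈ V T → ∃[ q ] x ∈ bag {T = T} q
    ∈V⇒∈bag (node X cs) x∈ with x∈p∪q⁻ X (Vs cs) x∈
    ... | inj₁ x∈X  = here , x∈X
    ... | inj₂ x∈cs = let i , q , x∈q = ∈Vs⇒∈bag cs x∈cs in there i q , x∈q

    ∈Vs⇒∈bag : (cs : List (Tree n)) {x : Fin n} → x ∈ Vs cs →
               ∃[ i ] Σ[ q ∈ Pos (List.lookup cs i) ] x ∈ bag q
    ∈Vs⇒∈bag []       x∈ = ⊥-elim (∉⊥ x∈)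
    ∈Vs⇒∈bag (c ∷ cs) x∈ with x∈p∪q⁻ (V c) (Vs cs) x∈
    ... | inj₁ x∈c  = let q , x∈q = ∈V⇒∈bag c x∈c in zero , q , x∈q
    ... | inj₂ x∈cs = let i , q , x∈q = ∈Vs⇒∈bag cs x∈cs in suc i , q , x∈q

  ∈V-subtree⇒∈bag : {T : Tree n} (c : Pos T) {x : Fin n} → x ∈ V (subtreeAt c) →
                    ∃[ q ] (c ≼ q × x ∈ bag q)
  ∈V-subtree⇒∈bag here        x∈ = let q , x∈q = ∈V⇒∈bag _ x∈ in q , here≼ , x∈q
  ∈V-subtree⇒∈bag (there i c) x∈ =
    let q , c≼q , x∈q = ∈V-subtree⇒∈bag c x∈ in there i q , there≼ c≼q , x∈q

  childPos : {T : Tree n} (t : Pos T) {X : Subset n} {cs : List (Tree n)} →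
             subtreeAt t ≡ node X cs → (i : Fin (length cs)) →
             ∃[ c ] (t ≼ c × subtreeAt c ≡ List.lookup cs i)
  childPos here        refl i = there i (root _) , here≼ , subtreeAt-root _
  childPos (there j t) t≡   i = let c , t≼c , c≡ = childPos t t≡ i in there j c , there≼ t≼c , c≡

module Separation {n : ℕ} {D : OrientedGraph n} {T : Tree n} (td : IsTreeDecomposition D T)
                  {t c : Pos T} (t≼c : t ≼ c) {w : Fin n} (w∈t : w ∈ bag t) (w∉c : w ∉ bag c) where

  open IsTreeDecomposition td
  open OrientedGraph D using (arc)

  ∉bag-below : {q : Pos T} → c ≼ q → w ∉ bag q
  ∉bag-below {q} c≼q w∈q = w∉c (coherence t q c (between⇒onPath t≼c c≼q) w w∈t w∈q)

  ∉V : w ∉ V (subtreeAt c)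
  ∉V w∈ = let q , c≼q , w∈q = ∈V-subtree⇒∈bag c w∈ in ∉bag-below c≼q w∈q

  neighbour∈bag : {x : Fin n} → x ∈ V (subtreeAt c) → arc w x ⊎ arc x w → x ∈ bag c
  neighbour∈bag {x} x∈ wx with edgeCover w x wx | ∈V-subtree⇒∈bag c x∈
  ... | p , w∈p , x∈p | q , c≼q , x∈q =
    coherence p q c (subtreeRoot-onPath c≼q (λ c≼p → ∉bag-below c≼p w∈p)) x x∈p x∈q

introduced-separated : ∀ {n} {D : OrientedGraph n} {T : Tree n} → IsTreeDecomposition D T →
  (t : Pos T) {Xt : Subset n} {t' : Tree n} {w : Fin n} →
  subtreeAt t ≡ node Xt (t' ∷ []) → w ∈ Xt → w ∉ rootBag t' →
  w ∉ V t' × (∀ {x} → x ∈ V t' → OrientedGraph.arc D w x ⊎ OrientedGraph.arc D x w → x ∈ rootBag t')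
introduced-separated td t t≡ w∈Xt w∉t' with childPos t t≡ zero
... | c , t≼c , refl = ∉V , neighbour∈bag
  where open Separation td t≼c (subst (_ ∈_) (sym (cong rootBag t≡)) w∈Xt) w∉t'

module _ {n : ℕ} where

  SameMembership : ∀ {k} → Vec (Subset n) k → Vec (Subset n) k → Fin n → Set
  SameMembership Ys Zs a = ∀ i → a ∈ lookup Ys i ⇔ a ∈ lookup Zs i

  lookup-cong-∈ : {Y Z : Subset n} {a : Fin n} → a ∈ Y ⇔ a ∈ Z → lookup Y a ≡ lookup Z a
  lookup-cong-∈ {Y} {Z} {a} a∈Y⇔a∈Z = ⇔→≡ (mk⇔
    (λ Ya → []=⇒lookup (to a∈Y⇔a∈Z (lookup⇒[]= a Y Ya)))
    (λ Za → []=⇒lookup (from a∈Y⇔a∈Z (lookup⇒[]= a Z Za))))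

  count-cong : ∀ {k} (Ys Zs : Vec (Subset n) k) {a b : Fin n} →
               SameMembership Ys Zs a → SameMembership Ys Zs b → count Ys a b ≡ count Zs a b
  count-cong []       []       _  _  = refl
  count-cong (Y ∷ Ys) (Z ∷ Zs) ha hb =
    cong₂ _+_ (cong₂ (λ p q → if p ∧ q then 1 else 0) (lookup-cong-∈ (ha zero)) (lookup-cong-∈ (hb zero)))
              (count-cong Ys Zs (ha ∘ suc) (hb ∘ suc))

  ∩-sameMembership : ∀ {k} {Ys Zs : Vec (Subset n) k} {X : Subset n} {a : Fin n} →
                     (∀ i → lookup Ys i ∩ X ≡ lookup Zs i) → a ∈ X → SameMembership Ys Zs a
  ∩-sameMembership {Ys = Ys} {X = X} Ys∩X≡Zs a∈X i = mk⇔
    (λ a∈Y → subst (_ ∈_) (Ys∩X≡Zs i) (x∈p∩q⁺ (a∈Y , a∈X)))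
    (λ a∈Z → p∩q⊆p (lookup Ys i) X (subst (_ ∈_) (sym (Ys∩X≡Zs i)) a∈Z))

  minus-sameMembership : ∀ {k} (Ys : Vec (Subset n) k) {w a : Fin n} →
                         a ≢ w → SameMembership Ys (map (_- w) Ys) a
  minus-sameMembership Ys {w} a≢w i rewrite lookup-map i (_- w) Ys =
    mk⇔ (λ a∈Y → x∈p∧x≢y⇒x∈p-y a∈Y a≢w) (p─q⊆p (lookup Ys i) ⁅ w ⁆)

  induced-⊆ : {A B : Subset n} {E : Rel n} {a b : Fin n} →
              B ⊆ A → a ∈ B → b ∈ B → induced A E a b ⇔ induced B E a b
  induced-⊆ B⊆A a∈B b∈B = mk⇔ (λ (_ , _ , e) → a∈B , b∈B , e) (λ (_ , _ , e) → B⊆A a∈B , B⊆A b∈B , e)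

  invert-cong : ∀ {k l} {R R' : Rel n} {Ys : Vec (Subset n) k} {Zs : Vec (Subset n) l} {a b : Fin n} →
                R a b ⇔ R' a b → R b a ⇔ R' b a → count Ys a b ≡ count Zs a b →
                invert R Ys a b ⇔ invert R' Zs a b
  invert-cong ab ba c = mk⇔
    (Sum.map (Product.map (to ab) (subst Even c)) (Product.map (to ba) (subst Odd c)))
    (Sum.map (Product.map (from ab) (subst Even (sym c))) (Product.map (from ba) (subst Odd (sym c))))

  invert-induced-⊆ : ∀ {k l} {A B : Subset n} {E : Rel n} (Ys : Vec (Subset n) k) (Zs : Vec (Subset n) l)
                     {a b : Fin n} → B ⊆ A → a ∈ B → b ∈ B → count Ys a b ≡ count Zs a b →
                     invert (induced A E) Ys a b ⇔ invert (induced B E) Zs a b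
  invert-induced-⊆ {A = A} {B} {E} Ys Zs B⊆A a∈B b∈B =
    invert-cong {R = induced A E} {induced B E} {Ys} {Zs}
                (induced-⊆ {E = E} B⊆A a∈B b∈B) (induced-⊆ {E = E} B⊆A b∈B a∈B)

  invert-induced-ends : ∀ {k} {A : Subset n} {E : Rel n} {Ys : Vec (Subset n) k} {a b : Fin n} →
                        invert (induced A E) Ys a b → a ∈ A × b ∈ A × (E a b ⊎ E b a)
  invert-induced-ends (inj₁ ((a∈ , b∈ , e) , _)) = a∈ , b∈ , inj₁ e
  invert-induced-ends (inj₂ ((b∈ , a∈ , e) , _)) = a∈ , b∈ , inj₂ e

module AuxiliaryReachability
  {n k : ℕ} (E : Rel n) (Xt X C : Subset n) (w : Fin n) (S : Vec (Subset n) k) (R R' : Rel n)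
  (Xt≡ : Xt ≡ X ∪ ⁅ w ⁆) (X⊆C : X ⊆ C) (w∉C : w ∉ C)
  (R-target : ∀ {a b} → R a b → b ≡ w ⊎ b ∈ C)
  (R⇔R' : ∀ {a b} → a ∈ C → b ∈ C → R a b ⇔ R' a b)
  (R'-ends : ∀ {a b} → R' a b → a ∈ C × b ∈ C)
  (R⇔A : ∀ {a b} → a ∈ Xt → b ∈ Xt → R a b ⇔ invert (induced Xt E) S a b)
  (neighbour∈X : ∀ {a} → a ∈ C → R w a ⊎ R a w → a ∈ X)
  where

  P' : Rel n
  P' a b = (a ≢ b × a ∈ X × b ∈ X) × DirPath R' a b

  Aux : Rel n
  Aux = auxDigraph E Xt X w P' S

  private
    Xt-cases : ∀ {x} → x ∈ Xt → x ≡ w ⊎ x ∈ X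
    Xt-cases x∈ = Sum.swap (Sum.map₂ (x∈⁅y⁆⇒x≡y w) (x∈p∪q⁻ X ⁅ w ⁆ (subst (_ ∈_) Xt≡ x∈)))

    X⊆Xt : X ⊆ Xt
    X⊆Xt x∈ = subst (_ ∈_) (sym Xt≡) (x∈p∪q⁺ (inj₁ x∈))

    w∈Xt : w ∈ Xt
    w∈Xt = subst (_ ∈_) (sym Xt≡) (x∈p∪q⁺ (inj₂ (x∈⁅x⁆ w)))

    C∩Xt⊆X : ∀ {x} → x ∈ C → x ∈ Xt → x ∈ X
    C∩Xt⊆X x∈C x∈Xt with Xt-cases x∈Xt
    ... | inj₁ refl = ⊥-elim (w∉C x∈C)
    ... | inj₂ x∈X  = x∈X

    reachArc : ∀ {a b} → a ∈ X → b ∈ X → Walk R' a b → Walk Aux a b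
    reachArc {a} {b} a∈ b∈ p with a ≟ b
    ... | yes refl = []
    ... | no  a≢b  = inj₁ ((a≢b , a∈ , b∈) , toDirPath p) ∷ []

    arcIntoW : ∀ {a} → a ∈ X → R a w → Aux a w
    arcIntoW a∈ e = inj₂ (inj₂ (refl , a∈ , to (R⇔A (X⊆Xt a∈) w∈Xt) e))

    arcOutOfW : ∀ {b} → b ∈ X → R w b → Aux w b
    arcOutOfW b∈ e = inj₂ (inj₁ (refl , b∈ , to (R⇔A w∈Xt (X⊆Xt b∈)) e))

  -- The accumulated R'-walk from a to x is the part of the walk since its last visit of w
  -- (or its start); it avoids w and therefore stays in C.
  mutual
    walkFromX : ∀ {a x y} → a ∈ X → Walk R' a x → x ∈ C → Walk R x y → y ∈ Xt → Walk Aux a y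
    walkFromX a∈ acc x∈ [] y∈ = reachArc a∈ (C∩Xt⊆X x∈ y∈) acc
    walkFromX a∈ acc x∈ (e ∷ p) y∈ with R-target e
    ... | inj₁ refl = let x∈X = neighbour∈X x∈ (inj₂ e) in
                      reachArc a∈ x∈X acc ++ʷ arcIntoW x∈X e ∷ walkFromW p y∈
    ... | inj₂ z∈   = walkFromX a∈ (acc ∷ʳ to (R⇔R' x∈ z∈) e) z∈ p y∈

    walkFromW : ∀ {y} → Walk R w y → y ∈ Xt → Walk Aux w y
    walkFromW []      _  = []
    walkFromW (e ∷ p) y∈ with R-target e
    ... | inj₁ refl = walkFromW p y∈
    ... | inj₂ z∈   = let z∈X = neighbour∈X z∈ (inj₁ e) in
                      arcOutOfW z∈X e ∷ walkFromX z∈X [] z∈ p y∈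

  walk⇒auxWalk : ∀ {u v} → u ∈ Xt → Walk R u v → v ∈ Xt → Walk Aux u v
  walk⇒auxWalk u∈ p v∈ with Xt-cases u∈
  ... | inj₁ refl = walkFromW p v∈
  ... | inj₂ u∈X  = walkFromX u∈X [] (X⊆C u∈X) p v∈

  private
    R'⇒R : ∀ {a b} → R' a b → R a b
    R'⇒R e = let a∈ , b∈ = R'-ends e in from (R⇔R' a∈ b∈) e

    A⇒R : ∀ {a b} → invert (induced Xt E) S a b → R a b
    A⇒R e = let a∈ , b∈ , _ = invert-induced-ends {E = E} {Ys = S} e in from (R⇔A a∈ b∈) e

  auxArc⇒walk : ∀ {a b} → Aux a b → Walk R a b
  auxArc⇒walk (inj₁ (_ , p , _))              = bindʷ (λ e → R'⇒R e ∷ []) p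
  auxArc⇒walk (inj₂ (inj₁ (refl , _ , e))) = A⇒R e ∷ []
  auxArc⇒walk (inj₂ (inj₂ (refl , _ , e))) = A⇒R e ∷ []

  dirPath⇔auxDirPath : ∀ {u v} → u ∈ Xt → v ∈ Xt → DirPath R u v ⇔ DirPath Aux u v
  dirPath⇔auxDirPath u∈ v∈ = mk⇔
    (λ (p , _) → toDirPath (walk⇒auxWalk u∈ p v∈))
    (λ (p , _) → toDirPath (bindʷ auxArc⇒walk p))

module IntroduceNode
  {n k : ℕ} (E : Rel n) (Vt Vc Xt X : Subset n) (w : Fin n) (S Ŝ : Vec (Subset n) k)
  (Vt≡ : Vt ≡ Xt ∪ Vc) (Xt≡ : Xt ≡ X ∪ ⁅ w ⁆) (X⊆Vc : X ⊆ Vc) (w∉Vc : w ∉ Vc)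
  (neighbour∈X : ∀ {x} → x ∈ Vc → E w x ⊎ E x w → x ∈ X)
  (Ŝ∩Xt≡S : ∀ i → lookup Ŝ i ∩ Xt ≡ lookup S i)
  where

  D̂ D̂' : Rel n
  D̂  = invert (induced Vt E) Ŝ
  D̂' = invert (induced Vc E) (map (_- w) Ŝ)

  private
    Xt⊆Vt : Xt ⊆ Vt
    Xt⊆Vt x∈ = subst (_ ∈_) (sym Vt≡) (p⊆p∪q Vc x∈)

    Vc⊆Vt : Vc ⊆ Vt
    Vc⊆Vt x∈ = subst (_ ∈_) (sym Vt≡) (q⊆p∪q Xt Vc x∈)

    ≢w : ∀ {x} → x ∈ Vc → x ≢ w
    ≢w x∈ refl = w∉Vc x∈

    D̂-ends : ∀ {a b} → D̂ a b → a ∈ Vt × b ∈ Vt × (E a b ⊎ E b a)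
    D̂-ends = invert-induced-ends {E = E} {Ys = Ŝ}

    D̂-target : ∀ {a b} → D̂ a b → b ≡ w ⊎ b ∈ Vc
    D̂-target e with x∈p∪q⁻ Xt Vc (subst (_ ∈_) Vt≡ (proj₁ (proj₂ (D̂-ends e))))
    ... | inj₂ b∈Vc = inj₂ b∈Vc
    ... | inj₁ b∈Xt with x∈p∪q⁻ X ⁅ w ⁆ (subst (_ ∈_) Xt≡ b∈Xt)
    ...   | inj₁ b∈X = inj₂ (X⊆Vc b∈X)
    ...   | inj₂ b∈w = inj₁ (x∈⁅y⁆⇒x≡y w b∈w)

    D̂⇔D̂' : ∀ {a b} → a ∈ Vc → b ∈ Vc → D̂ a b ⇔ D̂' a b
    D̂⇔D̂' a∈ b∈ = invert-induced-⊆ {E = E} Ŝ (map (_- w) Ŝ) Vc⊆Vt a∈ b∈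
      (count-cong Ŝ (map (_- w) Ŝ) (minus-sameMembership Ŝ (≢w a∈)) (minus-sameMembership Ŝ (≢w b∈)))

    D̂'-ends : ∀ {a b} → D̂' a b → a ∈ Vc × b ∈ Vc
    D̂'-ends e = let a∈ , b∈ , _ = invert-induced-ends {E = E} {Ys = map (_- w) Ŝ} e in a∈ , b∈

    D̂⇔A : ∀ {a b} → a ∈ Xt → b ∈ Xt → D̂ a b ⇔ invert (induced Xt E) S a b
    D̂⇔A a∈ b∈ = invert-induced-⊆ {E = E} Ŝ S Xt⊆Vt a∈ b∈
      (count-cong Ŝ S (Ŝ≈S a∈) (Ŝ≈S b∈))
      where Ŝ≈S : ∀ {x} → x ∈ Xt → SameMembership Ŝ S x
            Ŝ≈S = ∩-sameMembership {Ys = Ŝ} {S} Ŝ∩Xt≡S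

    D̂-neighbour∈X : ∀ {a} → a ∈ Vc → D̂ w a ⊎ D̂ a w → a ∈ X
    D̂-neighbour∈X a∈ = neighbour∈X a∈ ∘
      [ (λ e → proj₂ (proj₂ (D̂-ends e))) , (λ e → Sum.swap (proj₂ (proj₂ (D̂-ends e)))) ]′

  open AuxiliaryReachability E Xt X Vc w S D̂ D̂' Xt≡ X⊆Vc w∉Vc
    D̂-target D̂⇔D̂' D̂'-ends D̂⇔A D̂-neighbour∈X public
    using (dirPath⇔auxDirPath)

lemma10 : ∀ {n : ℕ} (D : OrientedGraph n) (T : Tree n) → IsNiceTreeDecomposition D T →
    -- t is an introduce node with bag Xt, unique child t' and X_t ∖ X_t' = {w}
    (t : Pos T) (Xt : Subset n) (t' : Tree n) (w : Fin n) →
    subtreeAt t ≡ node Xt (t' ∷ []) → w ∉ rootBag t' → Xt ≡ rootBag t' ∪ ⁅ w ⁆ →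
    -- the tuples S and Ŝ
    (k : ℕ) (S Ŝ : Vec (Subset n) k) →
    (∀ i → lookup S i ⊆ Xt) →
    (∀ i → lookup Ŝ i ⊆ V (subtreeAt t)) →
    (∀ i → lookup Ŝ i ∩ Xt ≡ lookup S i) →
    ∀ (u v : Fin n) → u ∈ Xt → v ∈ Xt → ¬ u ≡ v →
    DirPath (invert (induced (V (subtreeAt t)) (OrientedGraph.arc D)) Ŝ) u v
    ⇔
    DirPath (auxDigraph (OrientedGraph.arc D) Xt (rootBag t') w
               (λ a b → (¬ a ≡ b × a ∈ rootBag t' × b ∈ rootBag t') ×
                        DirPath (invert (induced (V t') (OrientedGraph.arc D))
                                        (map (λ Y → Y - w) Ŝ)) a b)
               S) u v
lemma10 D _ nice t Xt t' w t≡ w∉t' Xt≡ _ S Ŝ _ _ Ŝ∩Xt≡S _ _ u∈ v∈ _ =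
  let w∉V , neighbour∈X = introduced-separated (IsNiceTreeDecomposition.isTreeDecomposition nice)
                                               t t≡ w∈Xt w∉t'
  in IntroduceNode.dirPath⇔auxDirPath (OrientedGraph.arc D) (V (subtreeAt t)) (V t') Xt (rootBag t') w
       S Ŝ Vt≡ Xt≡ (rootBag⊆V t') w∉V neighbour∈X Ŝ∩Xt≡S u∈ v∈
  where
  Vt≡ : V (subtreeAt t) ≡ Xt ∪ V t'
  Vt≡ = trans (cong V t≡) (cong (Xt ∪_) (∪-identityʳ (V t')))

  w∈Xt : w ∈ Xt
  w∈Xt = subst (_ ∈_) (sym Xt≡) (x∈p∪q⁺ (inj₂ (x∈⁅x⁆ w)))
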